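{- A finite, directed acyclic abelian network all of whose nodes carry recurrent finite abelian processors emulates a recurrent finite abelian processor.
   Context: $\mathbb{N}=\{0,1,2,\dots\}$. A processor with finite input alphabet $A$, finite output alphabet $B$ and finite state space $Q$ consists of transition maps $t_i:Q\to Q$ and output maps $o_i:Q\to\mathbb{N}^B$ ($i\in A$): on receiving letter $i$ in state $q$ it moves to $t_i(q)$ and emits $(o_i(q))_b$ copies of letter $b$. It is abelian if $t_it_j=t_jt_i$ and $o_i+o_j\circ t_i=o_j+o_i\circ t_j$. A processor has an initial state $q^0$ from which every state is reachable by compositions of transition maps, and computes $F:\mathbb{N}^A\to\mathbb{N}^B$ giving the total output when, from $q^0$, it receives $x_a$ letters $a$ for each $a$. It is recurrent if for every pair of states $q,q'$ some finite sequence of input letters takes it from $q$ to $q'$. An abelian network is a finite directed multigraph with pairwise disjoint sets of dangling input edges (no tail), output edges and trash edges (no head); each node carries a finite abelian processor with an initial state, whose inputs/outputs are its incoming/outgoing edges. It runs by repeatedly feeding one letter from any non-output non-trash edge into the processor at its head, whose emitted letters go on its outgoing edges, halting when all letters are on output or trash edges; halting and output are independent of the choices. A network that halts on all inputs (in particular any directed acyclic network, i.e. one with no directed cycle) computes a function; it emulates a processor if it computes the same function. -}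

module Defs where

open import Data.Nat using (ℕ; zero; suc; _+_; _∸_)
open import Data.Fin using (Fin; _≟_) renaming (_<_ to _<ᶠ_)
open import Data.List using (List; []; _∷_; allFin; concatMap; replicate)
open import Data.Product using (Σ; ∃; _×_; _,_; proj₁; proj₂)
open import Data.Sum using (_⊎_; inj₁; inj₂)
open import Relation.Nullary using (yes; no)
open import Relation.Binary.PropositionalEquality using (_≡_; refl)
open import Relation.Binary.Construct.Closure.ReflexiveTransitive using (Star)
open import Function.Definitions using (Injective)
import Data.Sum.Properties as SumP
import Data.Product.Properties as ProdP

runT : ∀ {A Q : ℕ} → (Fin A → Fin Q → Fin Q) → List (Fin A) → Fin Q → Fin Q
runT t []       q = q
runT t (i ∷ w) q = runT t w (t i q)

runO : ∀ {A B Q : ℕ} → (Fin A → Fin Q → Fin Q) → (Fin A → Fin Q → Fin B → ℕ)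
     → List (Fin A) → Fin Q → Fin B → ℕ
runO t o []       q b = 0
runO t o (i ∷ w) q b = o i q b + runO t o w (t i q) b

record Processor (A B : ℕ) : Set where
  field
    Q  : ℕ
    t  : Fin A → Fin Q → Fin Q
    o  : Fin A → Fin Q → Fin B → ℕ
    q0 : Fin Q
    reachable : ∀ q → ∃ λ (w : List (Fin A)) → runT t w q0 ≡ q

module _ {A B : ℕ} (P : Processor A B) where
  open Processor P

  IsAbelian : Set
  IsAbelian = (∀ i j q → t i (t j q) ≡ t j (t i q))
            × (∀ i j q b → o i q b + o j (t i q) b ≡ o j q b + o i (t j q) b)

  IsRecurrent : Set
  IsRecurrent = ∀ q q' → ∃ λ (w : List (Fin A)) → runT t w q ≡ q'

  wordOf : (Fin A → ℕ) → List (Fin A)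
  wordOf x = concatMap (λ a → replicate (x a) a) (allFin A)

  -- the function F : ℕ^A → ℕ^B computed by the processor
  -- (for abelian processors the output does not depend on the order)
  computes : (Fin A → ℕ) → Fin B → ℕ
  computes x = runO t o (wordOf x) q0

IsRecurrentAbelian : ∀ {A B} → Processor A B → Set
IsRecurrentAbelian P = IsAbelian P × IsRecurrent P

-- Nodes are Fin n, numbered in a topological order.  Node k
-- has incoming edges (input ports) Fin (inDeg k) and outgoing edges
-- (output ports) Fin (outDeg k).  An edge is identified by its tail:
-- either a network input edge (Fin A, no tail) or an output port of a
-- node.  `nodeSrc k i` is the edge entering input port i of node k,
-- `outSrc b` is the node port from which network output edge b leaves.
-- Node output ports that feed nothing are the trash edges.

Src : (A n : ℕ) → (Fin n → ℕ) → Set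
Src A n outDeg = Fin A ⊎ Σ (Fin n) (λ k → Fin (outDeg k))

Tgt : (B n : ℕ) → (Fin n → ℕ) → Set
Tgt B n inDeg = Σ (Fin n) (λ k → Fin (inDeg k)) ⊎ Fin B

srcOf : ∀ {A B n} {inDeg outDeg : Fin n → ℕ}
      → ((k : Fin n) → Fin (inDeg k) → Src A n outDeg)
      → (Fin B → Σ (Fin n) (λ k → Fin (outDeg k)))
      → Tgt B n inDeg → Src A n outDeg
srcOf nodeSrc outSrc (inj₁ (k , i)) = nodeSrc k i
srcOf nodeSrc outSrc (inj₂ b)       = inj₂ (outSrc b)

record Network (A B : ℕ) : Set where
  field
    n       : ℕ
    inDeg   : Fin n → ℕ
    outDeg  : Fin n → ℕ
    proc    : (k : Fin n) → Processor (inDeg k) (outDeg k)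
    nodeSrc : (k : Fin n) → Fin (inDeg k) → Src A n outDeg
    outSrc  : Fin B → Σ (Fin n) (λ k → Fin (outDeg k))
    -- each edge has at most one head (edges are distinct letters)
    srcOf-injective : Injective _≡_ _≡_ (srcOf {inDeg = inDeg} nodeSrc outSrc)
    input-used      : ∀ (a : Fin A) → ∃ λ (x : Tgt B n inDeg) → srcOf nodeSrc outSrc x ≡ inj₁ a
    acyclic : ∀ k i k' j → nodeSrc k i ≡ inj₂ (k' , j) → k' <ᶠ k

module Semantics {A B : ℕ} (N : Network A B) where
  open Network N
  open Processor

  Edge : Set
  Edge = Src A n outDeg

  _≟E_ : (e e' : Edge) → Relation.Nullary.Dec (e ≡ e')
  _≟E_ = SumP.≡-dec _≟_ (ProdP.≡-dec _≟_ _≟_)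

  record Config : Set where
    constructor cfg
    field
      state : (k : Fin n) → Fin (Q (proc k))
      count : Edge → ℕ
  open Config public

  initial : (Fin A → ℕ) → Config
  initial x = cfg (λ k → q0 (proc k)) cnt
    where
    cnt : Edge → ℕ
    cnt (inj₁ a) = x a
    cnt (inj₂ _) = 0

  setState : (k : Fin n) → Fin (Q (proc k))
           → ((k' : Fin n) → Fin (Q (proc k'))) → (k' : Fin n) → Fin (Q (proc k'))
  setState k q s k' with k' ≟ k
  ... | yes refl = q
  ... | no _     = s k'

  emitted : (k : Fin n) → Fin (inDeg k) → Fin (Q (proc k)) → Edge → ℕ
  emitted k i q (inj₁ _) = 0
  emitted k i q (inj₂ (k' , j)) with k' ≟ k
  ... | yes refl = o (proc k) i q j
  ... | no _     = 0

  fire : Config → (k : Fin n) → Fin (inDeg k) → Config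
  fire c k i = cfg (setState k (t (proc k) i q) (state c))
                   (λ e → removed e + emitted k i q e)
    where
    q : Fin (Q (proc k))
    q = state c k
    removed : Edge → ℕ
    removed e with e ≟E nodeSrc k i
    ... | yes _ = count c e ∸ 1
    ... | no _  = count c e

  data Step : Config → Config → Set where
    step : ∀ c k i → (∃ λ m → count c (nodeSrc k i) ≡ suc m) → Step c (fire c k i)

  -- all letters are on output or trash edges
  Halted : Config → Set
  Halted c = ∀ k i → count c (nodeSrc k i) ≡ 0

  output : Config → Fin B → ℕ
  output c b = count c (inj₂ (outSrc b))

-- The network computes F : some (equivalently, by the abelian property,
-- every) complete execution from input x halts with output F x.
NetworkComputes : ∀ {A B} → Network A B → ((Fin A → ℕ) → Fin B → ℕ) → Set
NetworkComputes N F = ∀ x → ∃ λ c →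
  Star Step (initial x) c × Halted c × (∀ b → output c b ≡ F x b)
  where open Semantics N

Emulates : ∀ {A B} → Network A B → Processor A B → Set
Emulates N P = NetworkComputes N (computes P)

{-# OPTIONS --safe #-}
module Submission where

-- Call F : ℕ^X → ℕ^Y linear modulo L if it is monotone, maps 0 to 0 and satisfies
-- F (x + L z) = F x + F (L z).  In a recurrent abelian processor with Q states, pigeonhole and
-- recurrence give every letter i a power t_i^p = id with 0 < p ≤ Q, so the input Q! z returns every
-- state to itself and emits the same output from every state: the processor computes a function
-- linear modulo Q!.  If G is linear modulo L and F linear modulo M then F ∘ G is linear modulo M L,
-- so the network function, built layer by layer along the topological order, is linear modulo M ^ n
-- for a common multiple M of the nodes' moduli; firing the nodes in that order shows that the
-- network computes it.  Conversely a function G linear modulo L is computed by the processor whose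
-- state is the input count modulo L and which on letter a emits G (x + e_a) ∸ G x; its runs depend
-- only on letter counts, so it is abelian, and adding L letters a returns it to the same state, so it
-- is recurrent.

open import Defs
open import Data.Bool.Base using (if_then_else_)
open import Data.Empty using (⊥; ⊥-elim)
open import Data.Fin.Base as Fin using (Fin; zero; suc; toℕ; fromℕ<; finToFun; funToFin; combine)
open import Data.Fin.Properties using (_≟_; toℕ<n; toℕ-fromℕ<; toℕ-injective; pigeonhole; finToFun-funToFin; funToFin-finToFin)
open import Data.List.Base using (List; []; _∷_; _++_; replicate; concatMap; allFin; tabulate)
import Data.List.Properties as List
open import Data.List.Membership.Propositional.Properties using (∈-tabulate⁺)
open import Data.List.Relation.Binary.Permutation.Propositional
  using (_↭_; refl; prep; swap; trans; module PermutationReasoning)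
import Data.List.Relation.Binary.Permutation.Propositional.Properties as ↭
import Data.List.Relation.Unary.All.Properties as All
open import Data.Nat.Base
open import Data.Nat.Divisibility using (_∣_; divides; ∣-trans; m∣m*n; m≤n⇒m!∣n!)
open import Data.Nat.DivMod using (_mod_; _%_; _/_; m≡m%n+[m/n]*n; %-distribˡ-+; m%n%n≡m%n; [m+n]%n≡m%n; m<n⇒m%n≡m; m%n<n)
open import Data.Nat.ListAction using (product)
open import Data.Nat.ListAction.Properties using (∈⇒∣product; product≢0)
open import Data.Nat.Properties hiding (_≟_)
open import Data.Product.Base using (∃; _×_; _,_; proj₁; proj₂)
open import Data.Sum.Base using (inj₁; inj₂)
open import Function.Base using (_∘_; id)
open import Relation.Binary.Construct.Closure.ReflexiveTransitive using (Star; ε; _◅_; _◅◅_)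
open import Relation.Binary.PropositionalEquality
  using (_≡_; _≢_; _≗_; refl; sym; cong; cong₂; subst; module ≡-Reasoning)
  renaming (trans to ≡-trans)
open import Relation.Binary.Definitions using (tri<; tri≈; tri>)
open import Relation.Nullary using (yes; no; does)
open import Relation.Nullary.Decidable using (dec-true; dec-false)

infixl 6 _⊕_
infixr 7 _⊙_
infix  4 _≤ᵖ_

_⊕_ : {X : Set} → (X → ℕ) → (X → ℕ) → X → ℕ
(x ⊕ y) a = x a + y a

_⊙_ : {X : Set} → ℕ → (X → ℕ) → X → ℕ
(m ⊙ x) a = m * x a

𝟎 : {X : Set} → X → ℕ
𝟎 _ = 0

_≤ᵖ_ : {X : Set} → (X → ℕ) → (X → ℕ) → Set
x ≤ᵖ y = ∀ a → x a ≤ y a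

δ : ∀ {A} → Fin A → Fin A → ℕ
δ a c = if does (a ≟ c) then 1 else 0

δ-refl : ∀ {A} (a : Fin A) → δ a a ≡ 1
δ-refl a = cong (if_then 1 else 0) (dec-true (a ≟ a) refl)

*-δ : ∀ {A} (y : Fin A → ℕ) (a c : Fin A) → y a * δ a c ≡ y c * δ a c
*-δ y a c with a ≟ c
... | yes refl = refl
... | no _     = ≡-trans (*-zeroʳ (y a)) (sym (*-zeroʳ (y c)))

multiplicity : ∀ {A} → List (Fin A) → Fin A → ℕ
multiplicity []      = 𝟎
multiplicity (i ∷ w) = δ i ⊕ multiplicity w

multiplicity-++ : ∀ {A} (u w : List (Fin A)) c →
                  multiplicity (u ++ w) c ≡ multiplicity u c + multiplicity w c
multiplicity-++ []      w c = refl
multiplicity-++ (i ∷ u) w c =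
  ≡-trans (cong (δ i c +_) (multiplicity-++ u w c)) (sym (+-assoc (δ i c) _ _))

multiplicity-replicate : ∀ {A} m (a c : Fin A) → multiplicity (replicate m a) c ≡ m * δ a c
multiplicity-replicate zero    a c = refl
multiplicity-replicate (suc m) a c = cong (δ a c +_) (multiplicity-replicate m a c)

multiplicity-tabulate-suc : ∀ {A m} (f : Fin m → Fin A) c →
                            multiplicity (tabulate (Fin.suc ∘ f)) (suc c) ≡ multiplicity (tabulate f) c
multiplicity-tabulate-suc {m = zero}  f c = refl
multiplicity-tabulate-suc {m = suc m} f c = cong (δ (f zero) c +_) (multiplicity-tabulate-suc (f ∘ suc) c)

multiplicity-tabulate-suc-zero : ∀ {A m} (f : Fin m → Fin A) →
                                 multiplicity (tabulate (Fin.suc ∘ f)) zero ≡ 0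
multiplicity-tabulate-suc-zero {m = zero}  f = refl
multiplicity-tabulate-suc-zero {m = suc m} f = multiplicity-tabulate-suc-zero (f ∘ suc)

multiplicity-allFin : ∀ {A} (c : Fin A) → multiplicity (allFin A) c ≡ 1
multiplicity-allFin {suc A} zero    = cong suc (multiplicity-tabulate-suc-zero {A} id)
multiplicity-allFin {suc A} (suc c) = ≡-trans (multiplicity-tabulate-suc id c) (multiplicity-allFin c)

blocks : ∀ {A} → (Fin A → ℕ) → List (Fin A) → List (Fin A)
blocks y = concatMap (λ a → replicate (y a) a)

-- wordOf P from Defs, without its unused processor argument.
word : ∀ {A} → (Fin A → ℕ) → List (Fin A)
word {A} y = blocks y (allFin A)

multiplicity-blocks : ∀ {A} (y : Fin A → ℕ) l c → multiplicity (blocks y l) c ≡ y c * multiplicity l c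
multiplicity-blocks y []      c = sym (*-zeroʳ (y c))
multiplicity-blocks y (a ∷ l) c = begin
  multiplicity (replicate (y a) a ++ blocks y l) c
    ≡⟨ multiplicity-++ (replicate (y a) a) (blocks y l) c ⟩
  multiplicity (replicate (y a) a) c + multiplicity (blocks y l) c
    ≡⟨ cong₂ _+_ (≡-trans (multiplicity-replicate (y a) a c) (*-δ y a c)) (multiplicity-blocks y l c) ⟩
  y c * δ a c + y c * multiplicity l c
    ≡⟨ *-distribˡ-+ (y c) (δ a c) _ ⟨
  y c * multiplicity (a ∷ l) c
    ∎
  where open ≡-Reasoning

multiplicity-word : ∀ {A} (y : Fin A → ℕ) → multiplicity (word y) ≗ y
multiplicity-word {A} y c = begin
  multiplicity (word y) c           ≡⟨ multiplicity-blocks y (allFin A) c ⟩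
  y c * multiplicity (allFin A) c   ≡⟨ cong (y c *_) (multiplicity-allFin c) ⟩
  y c * 1                           ≡⟨ *-identityʳ (y c) ⟩
  y c                               ∎
  where open ≡-Reasoning

word-cong : ∀ {A} {y y' : Fin A → ℕ} → y ≗ y' → word y ≡ word y'
word-cong {A} y≗y' = List.concatMap-cong (λ a → cong (λ m → replicate m a) (y≗y' a)) (allFin A)

replicate-+ : ∀ {X : Set} m n (a : X) → replicate (m + n) a ≡ replicate m a ++ replicate n a
replicate-+ zero    n a = refl
replicate-+ (suc m) n a = cong (a ∷_) (replicate-+ m n a)

blocks-⊕ : ∀ {A} (y z : Fin A → ℕ) l → blocks (y ⊕ z) l ↭ blocks y l ++ blocks z l
blocks-⊕ y z []      = refl
blocks-⊕ y z (a ∷ l) = begin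
  replicate (y a + z a) a ++ blocks (y ⊕ z) l
    ≡⟨ cong (_++ blocks (y ⊕ z) l) (replicate-+ (y a) (z a) a) ⟩
  (replicate (y a) a ++ replicate (z a) a) ++ blocks (y ⊕ z) l
    ↭⟨ ↭.++⁺ˡ (replicate (y a) a ++ replicate (z a) a) (blocks-⊕ y z l) ⟩
  (replicate (y a) a ++ replicate (z a) a) ++ blocks y l ++ blocks z l
    ≡⟨ List.++-assoc (replicate (y a) a) _ _ ⟩
  replicate (y a) a ++ replicate (z a) a ++ blocks y l ++ blocks z l
    ↭⟨ ↭.++⁺ˡ (replicate (y a) a) (↭.shifts (replicate (z a) a) (blocks y l)) ⟩
  replicate (y a) a ++ blocks y l ++ replicate (z a) a ++ blocks z l
    ≡⟨ List.++-assoc (replicate (y a) a) _ _ ⟨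
  (replicate (y a) a ++ blocks y l) ++ replicate (z a) a ++ blocks z l
    ∎
  where open PermutationReasoning

blocks-𝟎 : ∀ {A} (l : List (Fin A)) → blocks 𝟎 l ≡ []
blocks-𝟎 []      = refl
blocks-𝟎 (a ∷ l) = blocks-𝟎 l

module Runs {A B} (P : Processor A B) where
  open Processor P

  runT-++ : ∀ u w q → runT t (u ++ w) q ≡ runT t w (runT t u q)
  runT-++ []      w q = refl
  runT-++ (i ∷ u) w q = runT-++ u w (t i q)

  runO-++ : ∀ u w q b → runO t o (u ++ w) q b ≡ runO t o u q b + runO t o w (runT t u q) b
  runO-++ []      w q b = refl
  runO-++ (i ∷ u) w q b =
    ≡-trans (cong (o i q b +_) (runO-++ u w (t i q) b)) (sym (+-assoc (o i q b) _ _))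

  computes-cong : ∀ {y y'} → y ≗ y' → computes P y ≗ computes P y'
  computes-cong y≗y' b = cong (λ w → runO t o w q0 b) (word-cong y≗y')

  computes-𝟎 : ∀ b → computes P 𝟎 b ≡ 0
  computes-𝟎 b = cong (λ w → runO t o w q0 b) (blocks-𝟎 (allFin A))

module AbelianRuns {A B} (P : Processor A B) (abelian : IsAbelian P) where
  open Processor P
  open Runs P
  private
    t-comm = proj₁ abelian
    o-comm = proj₂ abelian

  runT-↭ : ∀ {u w} → u ↭ w → ∀ q → runT t u q ≡ runT t w q
  runT-↭ refl           q = refl
  runT-↭ (prep i p)     q = runT-↭ p (t i q)
  runT-↭ {w = _ ∷ _ ∷ w} (swap i j p) q =
    ≡-trans (runT-↭ p (t j (t i q))) (cong (runT t w) (t-comm j i q))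
  runT-↭ (trans p p′)   q = ≡-trans (runT-↭ p q) (runT-↭ p′ q)

  runO-↭ : ∀ {u w} → u ↭ w → ∀ q b → runO t o u q b ≡ runO t o w q b
  runO-↭ refl           q b = refl
  runO-↭ (prep i p)     q b = cong (o i q b +_) (runO-↭ p (t i q) b)
  runO-↭ {u = i ∷ j ∷ u} {w = j ∷ i ∷ w} (swap i j p) q b = begin
    o i q b + (o j (t i q) b + runO t o u (t j (t i q)) b)
      ≡⟨ +-assoc (o i q b) _ _ ⟨
    o i q b + o j (t i q) b + runO t o u (t j (t i q)) b
      ≡⟨ cong₂ _+_ (o-comm i j q b) (≡-trans (runO-↭ p (t j (t i q)) b) (cong (λ r → runO t o w r b) (t-comm j i q))) ⟩
    o j q b + o i (t j q) b + runO t o w (t i (t j q)) b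
      ≡⟨ +-assoc (o j q b) _ _ ⟩
    o j q b + (o i (t j q) b + runO t o w (t i (t j q)) b) ∎
    where open ≡-Reasoning
  runO-↭ (trans p p′)   q b = ≡-trans (runO-↭ p q b) (runO-↭ p′ q b)

  runT-comm : ∀ u w q → runT t w (runT t u q) ≡ runT t u (runT t w q)
  runT-comm u w q = begin
    runT t w (runT t u q) ≡⟨ runT-++ u w q ⟨
    runT t (u ++ w) q     ≡⟨ runT-↭ (↭.++-comm u w) q ⟩
    runT t (w ++ u) q     ≡⟨ runT-++ w u q ⟩
    runT t u (runT t w q) ∎
    where open ≡-Reasoning

  runO-comm : ∀ u w q b → runO t o u q b + runO t o w (runT t u q) b ≡ runO t o w q b + runO t o u (runT t w q) b
  runO-comm u w q b = begin
    runO t o u q b + runO t o w (runT t u q) b ≡⟨ runO-++ u w q b ⟨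
    runO t o (u ++ w) q b                     ≡⟨ runO-↭ (↭.++-comm u w) q b ⟩
    runO t o (w ++ u) q b                     ≡⟨ runO-++ w u q b ⟩
    runO t o w q b + runO t o u (runT t w q) b ∎
    where open ≡-Reasoning

  computes-⊕ : ∀ y z b → computes P (y ⊕ z) b ≡ computes P y b + runO t o (word z) (runT t (word y) q0) b
  computes-⊕ y z b = ≡-trans (runO-↭ (blocks-⊕ y z (allFin A)) q0 b) (runO-++ (word y) (word z) q0 b)

  computes-mono : ∀ {y y'} → y ≤ᵖ y' → computes P y ≤ᵖ computes P y'
  computes-mono {y} {y'} y≤y' b = subst (computes P y b ≤_)
    (≡-trans (sym (computes-⊕ y (λ a → y' a ∸ y a) b)) (computes-cong (λ a → m+[n∸m]≡n (y≤y' a)) b))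
    (m≤m+n _ _)

-- Functions that are linear modulo L

record IsLinearModulo {X Y : Set} (L : ℕ) (F : (X → ℕ) → Y → ℕ) : Set where
  field
    resp-≗   : ∀ {x x'} → x ≗ x' → F x ≗ F x'
    map-𝟎    : F 𝟎 ≗ 𝟎
    monotone : ∀ {x x'} → x ≤ᵖ x' → F x ≤ᵖ F x'
    linear   : ∀ x z → F (x ⊕ L ⊙ z) ≗ F x ⊕ F (L ⊙ z)

module _ {X Y : Set} {L : ℕ} {F : (X → ℕ) → Y → ℕ} (F-lin : IsLinearModulo L F) where
  open IsLinearModulo F-lin

  linearModulo-scale : ∀ m z → F (L ⊙ m ⊙ z) ≗ m ⊙ F (L ⊙ z)
  linearModulo-scale zero    z y = ≡-trans (resp-≗ (λ a → *-zeroʳ L) y) (map-𝟎 y)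
  linearModulo-scale (suc m) z y = begin
    F (L ⊙ suc m ⊙ z) y            ≡⟨ resp-≗ (λ a → *-distribˡ-+ L (z a) (m * z a)) y ⟩
    F (L ⊙ z ⊕ L ⊙ m ⊙ z) y        ≡⟨ linear (L ⊙ z) (m ⊙ z) y ⟩
    F (L ⊙ z) y + F (L ⊙ m ⊙ z) y  ≡⟨ cong (F (L ⊙ z) y +_) (linearModulo-scale m z y) ⟩
    F (L ⊙ z) y + m * F (L ⊙ z) y  ∎
    where open ≡-Reasoning

  linearModulo-∣ : ∀ {M} → L ∣ M → IsLinearModulo M F
  linearModulo-∣ {M} (divides m M≡m*L) = record
    { resp-≗   = resp-≗
    ; map-𝟎    = map-𝟎
    ; monotone = monotone
    ; linear   = λ x z y → begin
        F (x ⊕ M ⊙ z) y              ≡⟨ resp-≗ (λ a → cong (x a +_) (M⊙≗L⊙m⊙ z a)) y ⟩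
        F (x ⊕ L ⊙ m ⊙ z) y          ≡⟨ linear x (m ⊙ z) y ⟩
        F x y + F (L ⊙ m ⊙ z) y      ≡⟨ cong (F x y +_) (resp-≗ (M⊙≗L⊙m⊙ z) y) ⟨
        F x y + F (M ⊙ z) y          ∎
    }
    where
    open ≡-Reasoning
    M⊙≗L⊙m⊙ : ∀ z → M ⊙ z ≗ L ⊙ m ⊙ z
    M⊙≗L⊙m⊙ z a = ≡-trans (cong (_* z a) (≡-trans M≡m*L (*-comm m L))) (*-assoc L m (z a))

  linearModulo-∸ : ∀ x x' z y → F (x ⊕ L ⊙ z) y ∸ F (x' ⊕ L ⊙ z) y ≡ F x y ∸ F x' y
  linearModulo-∸ x x' z y = begin
    F (x ⊕ L ⊙ z) y ∸ F (x' ⊕ L ⊙ z) y                ≡⟨ cong₂ _∸_ (linear x z y) (linear x' z y) ⟩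
    (F x y + F (L ⊙ z) y) ∸ (F x' y + F (L ⊙ z) y)    ≡⟨ cong₂ _∸_ (+-comm (F x y) _) (+-comm (F x' y) _) ⟩
    (F (L ⊙ z) y + F x y) ∸ (F (L ⊙ z) y + F x' y)    ≡⟨ [m+n]∸[m+o]≡n∸o (F (L ⊙ z) y) _ _ ⟩
    F x y ∸ F x' y                                    ∎
    where open ≡-Reasoning

linearModulo-∘ : ∀ {X Y Z : Set} {L M} {G : (X → ℕ) → Y → ℕ} {F : (Y → ℕ) → Z → ℕ} →
                 IsLinearModulo L G → IsLinearModulo M F → IsLinearModulo (M * L) (λ x → F (G x))
linearModulo-∘ {L = L} {M} {G} {F} G-lin F-lin = record
  { resp-≗   = λ x≗x' → F.resp-≗ (G.resp-≗ x≗x')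
  ; map-𝟎    = λ c → ≡-trans (F.resp-≗ G.map-𝟎 c) (F.map-𝟎 c)
  ; monotone = λ x≤x' → F.monotone (G.monotone x≤x')
  ; linear   = λ x z c → begin
      F (G (x ⊕ (M * L) ⊙ z)) c            ≡⟨ F.resp-≗ (G-split x z) c ⟩
      F (G x ⊕ M ⊙ G (L ⊙ z)) c            ≡⟨ F.linear (G x) (G (L ⊙ z)) c ⟩
      F (G x) c + F (M ⊙ G (L ⊙ z)) c      ≡⟨ cong (F (G x) c +_) (F.resp-≗ (G-scaled z) c) ⟨
      F (G x) c + F (G ((M * L) ⊙ z)) c    ∎
  }
  where
  module G = IsLinearModulo G-lin
  module F = IsLinearModulo F-lin
  open ≡-Reasoning
  reorder : ∀ z → (M * L) ⊙ z ≗ L ⊙ M ⊙ z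
  reorder z a = ≡-trans (cong (_* z a) (*-comm M L)) (*-assoc L M (z a))
  G-scaled : ∀ z → G ((M * L) ⊙ z) ≗ M ⊙ G (L ⊙ z)
  G-scaled z y = ≡-trans (G.resp-≗ (reorder z) y) (linearModulo-scale G-lin M z y)
  G-split : ∀ x z → G (x ⊕ (M * L) ⊙ z) ≗ G x ⊕ M ⊙ G (L ⊙ z)
  G-split x z y = begin
    G (x ⊕ (M * L) ⊙ z) y         ≡⟨ G.resp-≗ (λ a → cong (x a +_) (reorder z a)) y ⟩
    G (x ⊕ L ⊙ M ⊙ z) y           ≡⟨ G.linear x (M ⊙ z) y ⟩
    G x y + G (L ⊙ M ⊙ z) y       ≡⟨ cong (G x y +_) (linearModulo-scale G-lin M z y) ⟩
    G x y + M * G (L ⊙ z) y       ∎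

linearModulo-reindex : ∀ {X Y Y' : Set} {L} {F : (X → ℕ) → Y → ℕ} (f : Y' → Y) →
                       IsLinearModulo L F → IsLinearModulo L (λ x → F x ∘ f)
linearModulo-reindex f F-lin = record
  { resp-≗   = λ x≗x' → resp-≗ x≗x' ∘ f
  ; map-𝟎    = map-𝟎 ∘ f
  ; monotone = λ x≤x' → monotone x≤x' ∘ f
  ; linear   = λ x z → linear x z ∘ f
  }
  where open IsLinearModulo F-lin

-- Recurrent abelian processors compute functions linear modulo Q !

m≤n⇒m∣n! : ∀ {m n} → 0 < m → m ≤ n → m ∣ n !
m≤n⇒m∣n! {suc m} _ m≤n = ∣-trans (m∣m*n (m !)) (m≤n⇒m!∣n! m≤n)

module RecurrentAbelian {A B} (P : Processor A B) (recurrent-abelian : IsRecurrentAbelian P) where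
  open Processor P
  open Runs P
  open AbelianRuns P (proj₁ recurrent-abelian)

  Fixes : List (Fin A) → Set
  Fixes w = ∀ q → runT t w q ≡ q

  -- By recurrence q' = runT t u q for some u, and u commutes with w.
  fixes-everywhere : ∀ w {q} → runT t w q ≡ q → Fixes w
  fixes-everywhere w {q} w-fixes-q q' with proj₂ recurrent-abelian q q'
  ... | u , refl = ≡-trans (runT-comm u w q) (cong (runT t u) w-fixes-q)

  letter-cycle : ∀ i → ∃ λ p → 0 < p × p ≤ Q × Fixes (replicate p i)
  letter-cycle i
    with α , β , α<β , same ← pigeonhole (n<1+n Q) (λ m → runT t (replicate (toℕ m) i) q0) =
    p , z<s , p≤Q , fixes-everywhere (replicate p i) returns
    where
    open ≡-Reasoning
    p = suc (toℕ β ∸ suc (toℕ α))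
    β≡α+p : toℕ β ≡ toℕ α + p
    β≡α+p = sym (≡-trans (+-suc (toℕ α) _) (m+[n∸m]≡n α<β))
    p≤Q : p ≤ Q
    p≤Q = ≤-trans (m≤n+m p (toℕ α)) (≤-trans (≤-reflexive (sym β≡α+p)) (≤-pred (toℕ<n β)))
    returns : runT t (replicate p i) (runT t (replicate (toℕ α) i) q0) ≡ runT t (replicate (toℕ α) i) q0
    returns = begin
      runT t (replicate p i) (runT t (replicate (toℕ α) i) q0)  ≡⟨ runT-++ (replicate (toℕ α) i) _ q0 ⟨
      runT t (replicate (toℕ α) i ++ replicate p i) q0          ≡⟨ cong (λ w → runT t w q0) (replicate-+ (toℕ α) p i) ⟨
      runT t (replicate (toℕ α + p) i) q0                       ≡⟨ cong (λ m → runT t (replicate m i) q0) β≡α+p ⟨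
      runT t (replicate (toℕ β) i) q0                           ≡⟨ same ⟨
      runT t (replicate (toℕ α) i) q0                           ∎

  replicate-*-fixes : ∀ {p i} → Fixes (replicate p i) → ∀ m → Fixes (replicate (m * p) i)
  replicate-*-fixes         fixes zero    q = refl
  replicate-*-fixes {p} {i} fixes (suc m) q = begin
    runT t (replicate (p + m * p) i) q                        ≡⟨ cong (λ w → runT t w q) (replicate-+ p (m * p) i) ⟩
    runT t (replicate p i ++ replicate (m * p) i) q           ≡⟨ runT-++ (replicate p i) _ q ⟩
    runT t (replicate (m * p) i) (runT t (replicate p i) q)   ≡⟨ cong (runT t (replicate (m * p) i)) (fixes q) ⟩
    runT t (replicate (m * p) i) q                            ≡⟨ replicate-*-fixes fixes m q ⟩
    q                                                         ∎
    where open ≡-Reasoning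

  replicate-!-fixes : ∀ i → Fixes (replicate (Q !) i)
  replicate-!-fixes i with p , 0<p , p≤Q , fixes ← letter-cycle i
    with divides k Q!≡k*p ← m≤n⇒m∣n! 0<p p≤Q =
    subst (λ n → Fixes (replicate n i)) (sym Q!≡k*p) (replicate-*-fixes fixes k)

  blocks-fixes : ∀ {y} → (∀ a → Fixes (replicate (y a) a)) → ∀ l → Fixes (blocks y l)
  blocks-fixes         fixes []      q = refl
  blocks-fixes {y = y} fixes (a ∷ l) q =
    ≡-trans (runT-++ (replicate (y a) a) (blocks y l) q)
            (≡-trans (cong (runT t (blocks y l)) (fixes a q)) (blocks-fixes fixes l q))

  word-!-fixes : ∀ z → Fixes (word (Q ! ⊙ z))
  word-!-fixes z = blocks-fixes (λ a → subst (λ n → Fixes (replicate n a)) (*-comm (z a) (Q !))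
                                   (replicate-*-fixes (replicate-!-fixes a) (z a))) (allFin A)

  -- Every state is runT t u q0 for some u; commute u past w, which fixes q0.
  runO-fixes : ∀ {w} → Fixes w → ∀ q b → runO t o w q b ≡ runO t o w q0 b
  runO-fixes {w} fixes q b with reachable q
  ... | u , refl = +-cancelˡ-≡ (runO t o u q0 b) _ _ (begin
    runO t o u q0 b + runO t o w (runT t u q0) b  ≡⟨ runO-comm u w q0 b ⟩
    runO t o w q0 b + runO t o u (runT t w q0) b  ≡⟨ cong (λ q → runO t o w q0 b + runO t o u q b) (fixes q0) ⟩
    runO t o w q0 b + runO t o u q0 b             ≡⟨ +-comm (runO t o w q0 b) _ ⟩
    runO t o u q0 b + runO t o w q0 b             ∎)
    where open ≡-Reasoning

  computes-linearModulo : IsLinearModulo (Q !) (computes P)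
  computes-linearModulo = record
    { resp-≗   = computes-cong
    ; map-𝟎    = computes-𝟎
    ; monotone = computes-mono
    ; linear   = λ x z b → ≡-trans (computes-⊕ x (Q ! ⊙ z) b) (cong (computes P x b +_)
                   (runO-fixes {word (Q ! ⊙ z)} (word-!-fixes z) (runT t (word x) q0) b))
    }

-- Processors computing a given function linear modulo L

funToFin-cong : ∀ {m n} {f g : Fin m → Fin n} → f ≗ g → funToFin f ≡ funToFin g
funToFin-cong {zero}  f≗g = refl
funToFin-cong {suc m} f≗g = cong₂ combine (f≗g zero) (funToFin-cong (f≗g ∘ Fin.suc))

toℕ-mod : ∀ m n .{{_ : NonZero n}} → toℕ (m mod n) ≡ m % n
toℕ-mod m n = toℕ-fromℕ< (m%n<n m n)

mod-toℕ : ∀ {n} .{{_ : NonZero n}} (d : Fin n) → toℕ d mod n ≡ d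
mod-toℕ {n} d = toℕ-injective (≡-trans (toℕ-mod (toℕ d) n) (m<n⇒m%n≡m (toℕ<n d)))

%-≡⇒mod-≡ : ∀ {m m'} n .{{_ : NonZero n}} → m % n ≡ m' % n → m mod n ≡ m' mod n
%-≡⇒mod-≡ {m} {m'} n eq = toℕ-injective (≡-trans (toℕ-mod m n) (≡-trans eq (sym (toℕ-mod m' n))))

[m%n+o]%n≡[m+o]%n : ∀ m o n .{{_ : NonZero n}} → (m % n + o) % n ≡ (m + o) % n
[m%n+o]%n≡[m+o]%n m o n = begin
  (m % n + o) % n          ≡⟨ %-distribˡ-+ (m % n) o n ⟩
  (m % n % n + o % n) % n  ≡⟨ cong (λ r → (r + o % n) % n) (m%n%n≡m%n m n) ⟩
  (m % n + o % n) % n      ≡⟨ %-distribˡ-+ m o n ⟨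
  (m + o) % n              ∎
  where open ≡-Reasoning

-- The state after input x is x mod L, stored as the A base-L digits of an element of Fin (L ^ A).
module FromLinearModulo {A B} (L : ℕ) .{{_ : NonZero L}}
                        (G : (Fin A → ℕ) → Fin B → ℕ) (G-lin : IsLinearModulo L G) where
  open IsLinearModulo G-lin

  digits : Fin (L ^ A) → Fin A → ℕ
  digits s a = toℕ (finToFun s a)

  encode : (Fin A → ℕ) → Fin (L ^ A)
  encode x = funToFin (λ a → x a mod L)

  encode-% : ∀ {x x'} → (∀ a → x a % L ≡ x' a % L) → encode x ≡ encode x'
  encode-% x≡x' = funToFin-cong (λ a → %-≡⇒mod-≡ L (x≡x' a))

  encode-cong : ∀ {x x'} → x ≗ x' → encode x ≡ encode x'
  encode-cong x≗x' = encode-% (λ a → cong (_% L) (x≗x' a))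

  digits-encode : ∀ x a → digits (encode x) a ≡ x a % L
  digits-encode x a = ≡-trans (cong toℕ (finToFun-funToFin (λ a → x a mod L) a)) (toℕ-mod (x a) L)

  encode-digits : ∀ s → encode (digits s) ≡ s
  encode-digits s = ≡-trans (funToFin-cong {A} (mod-toℕ ∘ finToFun s)) (funToFin-finToFin {A} {L} s)

  t : Fin A → Fin (L ^ A) → Fin (L ^ A)
  t a s = encode (digits s ⊕ δ a)

  increment : Fin A → (Fin A → ℕ) → Fin B → ℕ
  increment a x b = G (x ⊕ δ a) b ∸ G x b

  o : Fin A → Fin (L ^ A) → Fin B → ℕ
  o a s = increment a (digits s)

  increment-% : ∀ a x b → increment a x b ≡ increment a (λ c → x c % L) b
  increment-% a x b = ≡-trans
    (cong₂ _∸_ (resp-≗ (λ c → ≡-trans (cong (_+ δ a c) (split c)) (+-comm-middle (x c % L) _ (δ a c))) b)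
               (resp-≗ split b))
    (linearModulo-∸ G-lin ((λ c → x c % L) ⊕ δ a) (λ c → x c % L) (λ c → x c / L) b)
    where
    split : ∀ c → x c ≡ x c % L + L * (x c / L)
    split c = ≡-trans (m≡m%n+[m/n]*n (x c) L) (cong (x c % L +_) (*-comm (x c / L) L))
    +-comm-middle : ∀ m n p → m + n + p ≡ m + p + n
    +-comm-middle m n p = ≡-trans (+-assoc m n p) (≡-trans (cong (m +_) (+-comm n p)) (sym (+-assoc m p n)))

  t-encode : ∀ a x → t a (encode x) ≡ encode (x ⊕ δ a)
  t-encode a x = encode-% (λ c → ≡-trans (cong (λ r → (r + δ a c) % L) (digits-encode x c))
                                          ([m%n+o]%n≡[m+o]%n (x c) (δ a c) L))

  o-encode : ∀ a x b → o a (encode x) b ≡ increment a x b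
  o-encode a x b = ≡-trans (cong₂ _∸_ (resp-≗ (λ c → cong (_+ δ a c) (digits-encode x c)) b)
                                      (resp-≗ (digits-encode x) b))
                           (sym (increment-% a x b))

  runT-encode : ∀ w x → runT t w (encode x) ≡ encode (x ⊕ multiplicity w)
  runT-encode []      x = encode-cong (λ c → sym (+-identityʳ (x c)))
  runT-encode (i ∷ w) x = begin
    runT t w (t i (encode x))               ≡⟨ cong (runT t w) (t-encode i x) ⟩
    runT t w (encode (x ⊕ δ i))             ≡⟨ runT-encode w (x ⊕ δ i) ⟩
    encode (x ⊕ δ i ⊕ multiplicity w)       ≡⟨ encode-cong (λ c → +-assoc (x c) (δ i c) _) ⟩
    encode (x ⊕ multiplicity (i ∷ w))       ∎
    where open ≡-Reasoning

  -- Monotonicity makes each ∸ in the increments a true difference, so the outputs telescope.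
  increment-+ : ∀ i x b → increment i x b + G x b ≡ G (x ⊕ δ i) b
  increment-+ i x b = m∸n+n≡m (monotone (λ c → m≤m+n (x c) (δ i c)) b)

  runO-encode : ∀ w x b → runO t o w (encode x) b + G x b ≡ G (x ⊕ multiplicity w) b
  runO-encode []      x b = resp-≗ (λ c → sym (+-identityʳ (x c))) b
  runO-encode (i ∷ w) x b = begin
    o i (encode x) b + runO t o w (t i (encode x)) b + G x b
      ≡⟨ cong₂ (λ m q → m + runO t o w q b + G x b) (o-encode i x b) (t-encode i x) ⟩
    increment i x b + runO t o w (encode (x ⊕ δ i)) b + G x b
      ≡⟨ cong (_+ G x b) (+-comm (increment i x b) _) ⟩
    runO t o w (encode (x ⊕ δ i)) b + increment i x b + G x b
      ≡⟨ +-assoc (runO t o w (encode (x ⊕ δ i)) b) _ _ ⟩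
    runO t o w (encode (x ⊕ δ i)) b + (increment i x b + G x b)
      ≡⟨ cong (runO t o w (encode (x ⊕ δ i)) b +_) (increment-+ i x b) ⟩
    runO t o w (encode (x ⊕ δ i)) b + G (x ⊕ δ i) b
      ≡⟨ runO-encode w (x ⊕ δ i) b ⟩
    G (x ⊕ δ i ⊕ multiplicity w) b
      ≡⟨ resp-≗ (λ c → +-assoc (x c) (δ i c) _) b ⟩
    G (x ⊕ multiplicity (i ∷ w)) b
      ∎
    where open ≡-Reasoning

  runT-multiplicity : ∀ {u w} → multiplicity u ≗ multiplicity w → ∀ s → runT t u s ≡ runT t w s
  runT-multiplicity {u} {w} u≗w s = begin
    runT t u s                               ≡⟨ cong (runT t u) (encode-digits s) ⟨
    runT t u (encode (digits s))             ≡⟨ runT-encode u (digits s) ⟩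
    encode (digits s ⊕ multiplicity u)       ≡⟨ encode-cong (λ c → cong (digits s c +_) (u≗w c)) ⟩
    encode (digits s ⊕ multiplicity w)       ≡⟨ runT-encode w (digits s) ⟨
    runT t w (encode (digits s))             ≡⟨ cong (runT t w) (encode-digits s) ⟩
    runT t w s                               ∎
    where open ≡-Reasoning

  runO-multiplicity : ∀ {u w} → multiplicity u ≗ multiplicity w → ∀ s b → runO t o u s b ≡ runO t o w s b
  runO-multiplicity {u} {w} u≗w s b = subst (λ s → runO t o u s b ≡ runO t o w s b) (encode-digits s)
    (+-cancelʳ-≡ (G (digits s) b) _ _ (begin
      runO t o u (encode (digits s)) b + G (digits s) b  ≡⟨ runO-encode u (digits s) b ⟩
      G (digits s ⊕ multiplicity u) b                    ≡⟨ resp-≗ (λ c → cong (digits s c +_) (u≗w c)) b ⟩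
      G (digits s ⊕ multiplicity w) b                    ≡⟨ runO-encode w (digits s) b ⟨
      runO t o w (encode (digits s)) b + G (digits s) b  ∎))
    where open ≡-Reasoning

  processor : Processor A B
  processor = record
    { Q = L ^ A ; t = t ; o = o ; q0 = encode 𝟎
    ; reachable = λ s → word (digits s) , ≡-trans (runT-encode (word (digits s)) 𝟎)
                                            (≡-trans (encode-cong (multiplicity-word (digits s))) (encode-digits s))
    }

  multiplicity-swap : ∀ (i j : Fin A) → multiplicity (i ∷ j ∷ []) ≗ multiplicity (j ∷ i ∷ [])
  multiplicity-swap i j c = ≡-trans (sym (+-assoc (δ i c) (δ j c) 0))
                           (≡-trans (cong (_+ 0) (+-comm (δ i c) (δ j c))) (+-assoc (δ j c) (δ i c) 0))

  processor-abelian : IsAbelian processor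
  processor-abelian =
      (λ i j s → runT-multiplicity {j ∷ i ∷ []} {i ∷ j ∷ []} (multiplicity-swap j i) s)
    , (λ i j s b → begin
        o i s b + o j (t i s) b          ≡⟨ cong (o i s b +_) (+-identityʳ (o j (t i s) b)) ⟨
        runO t o (i ∷ j ∷ []) s b        ≡⟨ runO-multiplicity {i ∷ j ∷ []} {j ∷ i ∷ []} (multiplicity-swap i j) s b ⟩
        runO t o (j ∷ i ∷ []) s b        ≡⟨ cong (o j s b +_) (+-identityʳ (o i (t j s) b)) ⟩
        o j s b + o i (t j s) b          ∎)
    where open ≡-Reasoning

  -- From digits d to digits d' feed (L ∸ d) + d' letters: d + (L ∸ d) + d' ≡ L + d'.
  processor-recurrent : IsRecurrent processor
  processor-recurrent s s' = word z , (begin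
    runT t (word z) s                          ≡⟨ cong (runT t (word z)) (encode-digits s) ⟨
    runT t (word z) (encode (digits s))        ≡⟨ runT-encode (word z) (digits s) ⟩
    encode (digits s ⊕ multiplicity (word z))  ≡⟨ encode-% wraps ⟩
    encode (digits s')                         ≡⟨ encode-digits s' ⟩
    s'                                         ∎)
    where
    open ≡-Reasoning
    z : Fin A → ℕ
    z a = (L ∸ digits s a) + digits s' a
    wraps : ∀ a → (digits s a + multiplicity (word z) a) % L ≡ digits s' a % L
    wraps a = begin
      (digits s a + multiplicity (word z) a) % L            ≡⟨ cong (λ m → (digits s a + m) % L) (multiplicity-word z a) ⟩
      (digits s a + ((L ∸ digits s a) + digits s' a)) % L   ≡⟨ cong (_% L) (+-assoc (digits s a) _ _) ⟨
      (digits s a + (L ∸ digits s a) + digits s' a) % L     ≡⟨ cong (λ m → (m + digits s' a) % L) (m+[n∸m]≡n (<⇒≤ (toℕ<n (finToFun s a)))) ⟩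
      (L + digits s' a) % L                                 ≡⟨ cong (_% L) (+-comm L (digits s' a)) ⟩
      (digits s' a + L) % L                                 ≡⟨ [m+n]%n≡m%n (digits s' a) L ⟩
      digits s' a % L                                       ∎

  processor-computes : ∀ x → computes processor x ≗ G x
  processor-computes x b = begin
    runO t o (word x) (encode 𝟎) b                ≡⟨ +-identityʳ _ ⟨
    runO t o (word x) (encode 𝟎) b + 0            ≡⟨ cong (runO t o (word x) (encode 𝟎) b +_) (map-𝟎 b) ⟨
    runO t o (word x) (encode 𝟎) b + G 𝟎 b        ≡⟨ runO-encode (word x) 𝟎 b ⟩
    G (𝟎 ⊕ multiplicity (word x)) b               ≡⟨ resp-≗ (multiplicity-word x) b ⟩
    G x b                                         ∎
    where open ≡-Reasoning

-- The function computed by an acyclic network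

module NetworkValues {A B} (N : Network A B) where
  open Network N
  open Semantics N using (Edge)

  layer : (Edge → ℕ) → Edge → ℕ
  layer v (inj₁ a)       = v (inj₁ a)
  layer v (inj₂ (k , j)) = computes (proc k) (v ∘ nodeSrc k) j

  embed : (Fin A → ℕ) → Edge → ℕ
  embed x (inj₁ a) = x a
  embed x (inj₂ _) = 0

  -- Once d ≥ depth e, values d x e is the total number of letters the network sends along e.
  values : ℕ → (Fin A → ℕ) → Edge → ℕ
  values zero    x = embed x
  values (suc d) x = layer (values d x)

  values-inj₁ : ∀ d x a → values d x (inj₁ a) ≡ x a
  values-inj₁ zero    x a = refl
  values-inj₁ (suc d) x a = values-inj₁ d x a

  depth : Edge → ℕ
  depth (inj₁ _)       = 0
  depth (inj₂ (k , _)) = suc (toℕ k)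

  depth-nodeSrc : ∀ k i → depth (nodeSrc k i) ≤ toℕ k
  depth-nodeSrc k i with nodeSrc k i in eq
  ... | inj₁ _         = z≤n
  ... | inj₂ (k' , j') = acyclic k i k' j' eq

  values-stable : ∀ x d e → depth e ≤ d → values (suc d) x e ≡ values d x e
  values-stable x d       (inj₁ a)       _         = refl
  values-stable x (suc d) (inj₂ (k , j)) (s≤s k≤d) = Runs.computes-cong (proc k)
    (λ i → values-stable x d (nodeSrc k i) (≤-trans (depth-nodeSrc k i) k≤d)) j

  values-fixed : ∀ x e → layer (values n x) e ≡ values n x e
  values-fixed x e = values-stable x n e (depth≤n e)
    where
    depth≤n : ∀ e → depth e ≤ n
    depth≤n (inj₁ _)       = z≤n
    depth≤n (inj₂ (k , _)) = toℕ<n k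

  embed-linearModulo : IsLinearModulo 1 embed
  embed-linearModulo = record
    { resp-≗   = λ { x≗x' (inj₁ a) → x≗x' a ; x≗x' (inj₂ _) → refl }
    ; map-𝟎    = λ { (inj₁ a) → refl ; (inj₂ _) → refl }
    ; monotone = λ { x≤x' (inj₁ a) → x≤x' a ; x≤x' (inj₂ _) → z≤n }
    ; linear   = λ { x z (inj₁ a) → refl ; x z (inj₂ _) → refl }
    }

  module _ {M} (nodes-lin : ∀ k → IsLinearModulo M (computes (proc k))) where
    private module Node k = IsLinearModulo (nodes-lin k)

    layer-linearModulo : IsLinearModulo M layer
    layer-linearModulo = record
      { resp-≗   = λ { v≗v' (inj₁ a) → v≗v' (inj₁ a)
                     ; v≗v' (inj₂ (k , j)) → Node.resp-≗ k (v≗v' ∘ nodeSrc k) j }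
      ; map-𝟎    = λ { (inj₁ a) → refl ; (inj₂ (k , j)) → Node.map-𝟎 k j }
      ; monotone = λ { v≤v' (inj₁ a) → v≤v' (inj₁ a)
                     ; v≤v' (inj₂ (k , j)) → Node.monotone k (v≤v' ∘ nodeSrc k) j }
      ; linear   = λ { v z (inj₁ a) → refl
                     ; v z (inj₂ (k , j)) → Node.linear k (v ∘ nodeSrc k) (z ∘ nodeSrc k) j }
      }

    values-linearModulo : ∀ d → IsLinearModulo (M ^ d) (values d)
    values-linearModulo zero    = embed-linearModulo
    values-linearModulo (suc d) = linearModulo-∘ (values-linearModulo d) layer-linearModulo

-- Firing the nodes in topological order

module Execution {A B} (N : Network A B) where
  open Network N
  open Semantics N
  open NetworkValues N
  open Processor

  setState-same : ∀ k q s → setState k q s k ≡ q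
  setState-same k q s with k ≟ k
  ... | yes refl = refl
  ... | no k≢k   = ⊥-elim (k≢k refl)

  setState-other : ∀ k q s k' → k' ≢ k → setState k q s k' ≡ s k'
  setState-other k q s k' k'≢k with k' ≟ k
  ... | yes k'≡k = ⊥-elim (k'≢k k'≡k)
  ... | no _     = refl

  emitted-own : ∀ k i q j → emitted k i q (inj₂ (k , j)) ≡ o (proc k) i q j
  emitted-own k i q j with k ≟ k
  ... | yes refl = refl
  ... | no k≢k   = ⊥-elim (k≢k refl)

  emitted-foreign : ∀ k i q e → (∀ j → inj₂ (k , j) ≢ e) → emitted k i q e ≡ 0
  emitted-foreign k i q (inj₁ _)         _        = refl
  emitted-foreign k i q (inj₂ (k' , j)) not-own with k' ≟ k
  ... | yes refl = ⊥-elim (not-own j refl)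
  ... | no _     = refl

  nodeOutput : (k : Fin n) → List (Fin (inDeg k)) → Fin (Q (proc k)) → Fin (outDeg k) → ℕ
  nodeOutput k = runO (t (proc k)) (o (proc k))

  count-fire-consumed : ∀ c k i → count (fire c k i) (nodeSrc k i)
                                  ≡ (count c (nodeSrc k i) ∸ 1) + emitted k i (state c k) (nodeSrc k i)
  count-fire-consumed c k i with nodeSrc k i ≟E nodeSrc k i
  ... | yes _ = refl
  ... | no ≢  = ⊥-elim (≢ refl)

  count-fire-other : ∀ c k i e → e ≢ nodeSrc k i →
                     count (fire c k i) e ≡ count c e + emitted k i (state c k) e
  count-fire-other c k i e e≢ with e ≟E nodeSrc k i
  ... | yes e≡ = ⊥-elim (e≢ e≡)
  ... | no _   = refl

  nodeSrc-injectiveˡ : ∀ {k k' i i'} → nodeSrc k i ≡ nodeSrc k' i' → k ≡ k'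
  nodeSrc-injectiveˡ eq with srcOf-injective eq
  ... | refl = refl

  nodeSrc-injectiveʳ : ∀ {k i i'} → nodeSrc k i ≡ nodeSrc k i' → i ≡ i'
  nodeSrc-injectiveʳ eq with srcOf-injective eq
  ... | refl = refl

  own-output≢nodeSrc : ∀ k i j → inj₂ (k , j) ≢ nodeSrc k i
  own-output≢nodeSrc k i j eq = <-irrefl refl (acyclic k i k j (sym eq))

  count-fire-input : ∀ c k i i' → count (fire c k i) (nodeSrc k i') ≡ count c (nodeSrc k i') ∸ δ i i'
  count-fire-input c k i i' with i ≟ i'
  ... | yes refl = begin
    count (fire c k i) (nodeSrc k i)
      ≡⟨ count-fire-consumed c k i ⟩
    (count c (nodeSrc k i) ∸ 1) + emitted k i (state c k) (nodeSrc k i)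
      ≡⟨ cong (_ +_) (emitted-foreign k i _ _ (own-output≢nodeSrc k i)) ⟩
    (count c (nodeSrc k i) ∸ 1) + 0
      ≡⟨ +-identityʳ _ ⟩
    count c (nodeSrc k i) ∸ 1
      ∎
    where open ≡-Reasoning
  ... | no i≢i' = begin
    count (fire c k i) (nodeSrc k i')
      ≡⟨ count-fire-other c k i _ (i≢i' ∘ sym ∘ nodeSrc-injectiveʳ) ⟩
    count c (nodeSrc k i') + emitted k i (state c k) (nodeSrc k i')
      ≡⟨ cong (_ +_) (emitted-foreign k i _ _ (own-output≢nodeSrc k i')) ⟩
    count c (nodeSrc k i') + 0
      ≡⟨ +-identityʳ _ ⟩
    count c (nodeSrc k i')
      ∎
    where open ≡-Reasoning

  count-fire-output : ∀ c k i j →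
                      count (fire c k i) (inj₂ (k , j)) ≡ count c (inj₂ (k , j)) + o (proc k) i (state c k) j
  count-fire-output c k i j = ≡-trans (count-fire-other c k i _ (own-output≢nodeSrc k i j))
                                      (cong (count c (inj₂ (k , j)) +_) (emitted-own k i (state c k) j))

  count-fire-unrelated : ∀ c k i e → (∀ i' → nodeSrc k i' ≢ e) → (∀ j → inj₂ (k , j) ≢ e) →
                         count (fire c k i) e ≡ count c e
  count-fire-unrelated c k i e not-input not-output =
    ≡-trans (count-fire-other c k i e (not-input i ∘ sym))
            (≡-trans (cong (count c e +_) (emitted-foreign k i (state c k) e not-output)) (+-identityʳ _))

  record Fired (k : Fin n) (w : List (Fin (inDeg k))) (c : Config) : Set where
    field
      result          : Config
      steps           : Star Step c result
      state-other     : ∀ k' → k' ≢ k → state result k' ≡ state c k'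
      count-input     : ∀ i → count result (nodeSrc k i) ≡ count c (nodeSrc k i) ∸ multiplicity w i
      count-output    : ∀ j → count result (inj₂ (k , j)) ≡ count c (inj₂ (k , j)) + nodeOutput k w (state c k) j
      count-unrelated : ∀ e → (∀ i → nodeSrc k i ≢ e) → (∀ j → inj₂ (k , j) ≢ e) →
                        count result e ≡ count c e

  fire-word : ∀ k w c → multiplicity w ≤ᵖ count c ∘ nodeSrc k → Fired k w c
  fire-word k []      c _         = record
    { result = c ; steps = ε ; state-other = λ _ _ → refl ; count-input = λ _ → refl
    ; count-output = λ _ → sym (+-identityʳ _) ; count-unrelated = λ _ _ _ → refl }
  fire-word k (i ∷ w) c available = record
    { result          = result
    ; steps           = step c k i letter ◅ steps
    ; state-other     = λ k' k'≢k → ≡-trans (state-other k' k'≢k) (setState-other k _ (state c) k' k'≢k)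
    ; count-input     = λ i' → begin
        count result (nodeSrc k i')
          ≡⟨ count-input i' ⟩
        count (fire c k i) (nodeSrc k i') ∸ multiplicity w i'
          ≡⟨ cong (_∸ multiplicity w i') (count-fire-input c k i i') ⟩
        count c (nodeSrc k i') ∸ δ i i' ∸ multiplicity w i'
          ≡⟨ ∸-+-assoc (count c (nodeSrc k i')) (δ i i') _ ⟩
        count c (nodeSrc k i') ∸ multiplicity (i ∷ w) i'
          ∎
    ; count-output    = λ j → begin
        count result (inj₂ (k , j))
          ≡⟨ count-output j ⟩
        count (fire c k i) (inj₂ (k , j)) + nodeOutput k w (state (fire c k i) k) j
          ≡⟨ cong₂ _+_ (count-fire-output c k i j) (cong (λ q → nodeOutput k w q j) (setState-same k _ (state c))) ⟩
        count c (inj₂ (k , j)) + o (proc k) i (state c k) j + nodeOutput k w (t (proc k) i (state c k)) j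
          ≡⟨ +-assoc (count c (inj₂ (k , j))) _ _ ⟩
        count c (inj₂ (k , j)) + nodeOutput k (i ∷ w) (state c k) j
          ∎
    ; count-unrelated = λ e not-input not-output →
        ≡-trans (count-unrelated e not-input not-output) (count-fire-unrelated c k i e not-input not-output)
    }
    where
    open ≡-Reasoning
    letter : ∃ λ m → count c (nodeSrc k i) ≡ suc m
    letter with count c (nodeSrc k i) | available i
    ... | suc m | _ = m , refl
    ... | zero  | δii+w≤0 = ⊥-elim (n≮0 (subst (_≤ 0) (cong (_+ multiplicity w i) (δ-refl i)) δii+w≤0))
    available′ : multiplicity w ≤ᵖ count (fire c k i) ∘ nodeSrc k
    available′ i' = subst (multiplicity w i' ≤_) (sym (count-fire-input c k i i'))
      (m+n≤o⇒m≤o∸n (multiplicity w i') (subst (_≤ count c (nodeSrc k i')) (+-comm (δ i i') _) (available i')))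
    open Fired (fire-word k w (fire c k i) available′)

  module Schedule (x : Fin A → ℕ) where

    pending : ℕ → Edge → ℕ
    pending m (inj₁ a)       = x a
    pending m (inj₂ (k , j)) = if does (toℕ k <? m) then values n x (inj₂ (k , j)) else 0

    pending-done : ∀ m k j → toℕ k < m → pending m (inj₂ (k , j)) ≡ values n x (inj₂ (k , j))
    pending-done m k j k<m = cong (if_then values n x (inj₂ (k , j)) else 0) (dec-true (toℕ k <? m) k<m)

    pending-todo : ∀ m k j → m ≤ toℕ k → pending m (inj₂ (k , j)) ≡ 0
    pending-todo m k j m≤k = cong (if_then values n x (inj₂ (k , j)) else 0) (dec-false (toℕ k <? m) (≤⇒≯ m≤k))

    pending-suc : ∀ m k j → toℕ k ≢ m → pending (suc m) (inj₂ (k , j)) ≡ pending m (inj₂ (k , j))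
    pending-suc m k j k≢m with <-cmp (toℕ k) m
    ... | tri< k<m _ _ = ≡-trans (pending-done (suc m) k j (m<n⇒m<1+n k<m)) (sym (pending-done m k j k<m))
    ... | tri≈ _ k≡m _ = ⊥-elim (k≢m k≡m)
    ... | tri> _ _ m<k = ≡-trans (pending-todo (suc m) k j m<k) (sym (pending-todo m k j (<⇒≤ m<k)))

    Unconsumed : ℕ → Edge → Set
    Unconsumed m e = ∀ k i → nodeSrc k i ≡ e → m ≤ toℕ k

    unconsumed-weaken : ∀ {m e} → Unconsumed (suc m) e → Unconsumed m e
    unconsumed-weaken unconsumed k i eq = <⇒≤ (unconsumed k i eq)

    -- The configuration once nodes 0, …, m ∸ 1 have processed all their input.
    record Scheduled (m : ℕ) (c : Config) : Set where
      field
        idle    : ∀ k → m ≤ toℕ k → state c k ≡ q0 (proc k)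
        drained : ∀ k i → toℕ k < m → count c (nodeSrc k i) ≡ 0
        waiting : ∀ e → Unconsumed m e → count c e ≡ pending m e

    scheduled-initial : Scheduled 0 (initial x)
    scheduled-initial = record
      { idle    = λ _ _ → refl
      ; drained = λ _ _ ()
      ; waiting = λ { (inj₁ a) _ → refl ; (inj₂ (k , j)) _ → sym (pending-todo 0 k j z≤n) }
      }

    module FireNext (m : ℕ) (m<n : m < n) (c : Config) (S : Scheduled m c) where
      open Scheduled S

      k : Fin n
      k = fromℕ< m<n

      k≡m : toℕ k ≡ m
      k≡m = toℕ-fromℕ< m<n

      ≡m⇒≡k : ∀ {k'} → toℕ k' ≡ m → k' ≡ k
      ≡m⇒≡k k'≡m = toℕ-injective (≡-trans k'≡m (sym k≡m))

      ≢k : ∀ {k'} → toℕ k' ≢ m → k' ≢ k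
      ≢k k'≢m refl = k'≢m k≡m

      inputs : Fin (inDeg k) → ℕ
      inputs i = values n x (nodeSrc k i)

      pending-input : ∀ i → pending m (nodeSrc k i) ≡ inputs i
      pending-input i with nodeSrc k i in eq
      ... | inj₁ a         = sym (values-inj₁ n x a)
      ... | inj₂ (k' , j') = pending-done m k' j' (subst (toℕ k' <_) k≡m (acyclic k i k' j' eq))

      count-inputs : ∀ i → count c (nodeSrc k i) ≡ inputs i
      count-inputs i = ≡-trans (waiting (nodeSrc k i) only-k) (pending-input i)
        where
        only-k : Unconsumed m (nodeSrc k i)
        only-k k' i' eq = ≤-reflexive (≡-trans (sym k≡m) (cong toℕ (sym (nodeSrc-injectiveˡ eq))))

      fired : Fired k (word inputs) c
      fired = fire-word k (word inputs) c
                (λ i → ≤-reflexive (≡-trans (multiplicity-word inputs i) (sym (count-inputs i))))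
      open Fired fired public

      idle′ : ∀ k' → suc m ≤ toℕ k' → state result k' ≡ q0 (proc k')
      idle′ k' m<k' = ≡-trans (state-other k' (≢k (>⇒≢ m<k'))) (idle k' (<⇒≤ m<k'))

      drained′ : ∀ k' i → toℕ k' < suc m → count result (nodeSrc k' i) ≡ 0
      drained′ k' i k'<1+m with m≤n⇒m<n∨m≡n (≤-pred k'<1+m)
      ... | inj₂ k'≡m with ≡m⇒≡k k'≡m
      ...   | refl = begin
        count result (nodeSrc k i)                              ≡⟨ count-input i ⟩
        count c (nodeSrc k i) ∸ multiplicity (word inputs) i    ≡⟨ cong₂ _∸_ (count-inputs i) (multiplicity-word inputs i) ⟩
        inputs i ∸ inputs i                                     ≡⟨ n∸n≡0 (inputs i) ⟩
        0                                                       ∎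
        where open ≡-Reasoning
      drained′ k' i k'<1+m | inj₁ k'<m =
        ≡-trans (count-unrelated (nodeSrc k' i) not-input not-output) (drained k' i k'<m)
        where
        not-input : ∀ i' → nodeSrc k i' ≢ nodeSrc k' i
        not-input i' eq = ≢k (<⇒≢ k'<m) (sym (nodeSrc-injectiveˡ eq))
        not-output : ∀ j → inj₂ (k , j) ≢ nodeSrc k' i
        not-output j eq = <-asym k'<m (subst (_< toℕ k') k≡m (acyclic k' i k j (sym eq)))

      waiting-unrelated : ∀ e → Unconsumed (suc m) e → (∀ j → inj₂ (k , j) ≢ e) →
                          count result e ≡ pending m e
      waiting-unrelated e unconsumed not-output =
        ≡-trans (count-unrelated e not-input not-output) (waiting e (unconsumed-weaken unconsumed))
        where
        not-input : ∀ i → nodeSrc k i ≢ e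
        not-input i eq = <-irrefl (sym k≡m) (unconsumed k i eq)

      waiting′ : ∀ e → Unconsumed (suc m) e → count result e ≡ pending (suc m) e
      waiting′ (inj₁ a) unconsumed = waiting-unrelated (inj₁ a) unconsumed (λ _ ())
      waiting′ (inj₂ (k' , j)) unconsumed with k' ≟ k
      ... | no k'≢k = ≡-trans (waiting-unrelated (inj₂ (k' , j)) unconsumed (λ { _ refl → k'≢k refl }))
                              (sym (pending-suc m k' j (k'≢k ∘ ≡m⇒≡k)))
      ... | yes refl = begin
        count result (inj₂ (k , j))
          ≡⟨ count-output j ⟩
        count c (inj₂ (k , j)) + nodeOutput k (word inputs) (state c k) j
          ≡⟨ cong₂ _+_ (≡-trans (waiting (inj₂ (k , j)) (unconsumed-weaken unconsumed))
                                (pending-todo m k j (≤-reflexive (sym k≡m))))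
                       (cong (λ q → nodeOutput k (word inputs) q j) (idle k (≤-reflexive (sym k≡m)))) ⟩
        computes (proc k) inputs j
          ≡⟨ values-fixed x (inj₂ (k , j)) ⟩
        values n x (inj₂ (k , j))
          ≡⟨ pending-done (suc m) k j (≤-reflexive (cong suc k≡m)) ⟨
        pending (suc m) (inj₂ (k , j))
          ∎
        where open ≡-Reasoning

      scheduled′ : Scheduled (suc m) result
      scheduled′ = record { idle = idle′ ; drained = drained′ ; waiting = waiting′ }

    schedule : ∀ m → m ≤ n → ∃ λ c → Star Step (initial x) c × Scheduled m c
    schedule zero    _   = initial x , ε , scheduled-initial
    schedule (suc m) m<n with c , run , S ← schedule m (<⇒≤ m<n) =
      result , run ◅◅ steps , scheduled′
      where open FireNext m m<n c S

  -- Output edges have no head, so they are never consumed.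
  network-computes-values : NetworkComputes N (λ x b → values n x (inj₂ (outSrc b)))
  network-computes-values x with c , run , S ← Schedule.schedule x n ≤-refl =
    c , run , (λ k i → drained k i (toℕ<n k)) ,
    (λ b → ≡-trans (waiting (inj₂ (outSrc b)) (λ k i eq → ⊥-elim (node≢output (srcOf-injective eq))))
                   (pending-done n (proj₁ (outSrc b)) (proj₂ (outSrc b)) (toℕ<n _)))
    where
    open Schedule x
    open Scheduled S
    node≢output : ∀ {p b} → _≡_ {A = Tgt B n inDeg} (inj₁ p) (inj₂ b) → ⊥
    node≢output ()

networkComputes-≗ : ∀ {A B} (N : Network A B) {F F' : (Fin A → ℕ) → Fin B → ℕ} →
                    (∀ x → F x ≗ F' x) → NetworkComputes N F → NetworkComputes N F'
networkComputes-≗ N F≗F' computes-F x with c , run , halted , out ← computes-F x =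
  c , run , halted , λ b → ≡-trans (out b) (F≗F' x b)

proposition2p7 : ∀ {A B : ℕ} (N : Network A B)
    → (∀ (k : Fin (Network.n N)) → IsRecurrentAbelian (Network.proc N k))
    → ∃ λ (P : Processor A B) → IsRecurrentAbelian P × Emulates N P
proposition2p7 N nodes-recurrent-abelian =
  processor , (processor-abelian , processor-recurrent) ,
  networkComputes-≗ N (λ x b → sym (processor-computes x b)) (network-computes-values N)
  where
  open Network N
  open NetworkValues N
  open Execution using (network-computes-values)

  M : ℕ
  M = product (tabulate λ k → Processor.Q (proc k) !)

  instance
    M≢0 : NonZero M
    M≢0 = product≢0 (All.tabulate⁺ λ k → Processor.Q (proc k) !≢0)
    L≢0 : NonZero (M ^ n)
    L≢0 = m^n≢0 M n

  nodes-linear : ∀ k → IsLinearModulo M (computes (proc k))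
  nodes-linear k = linearModulo-∣ (RecurrentAbelian.computes-linearModulo (proc k) (nodes-recurrent-abelian k))
                                  (∈⇒∣product (∈-tabulate⁺ k))

  open FromLinearModulo (M ^ n) (λ x b → values n x (inj₂ (outSrc b)))
         (linearModulo-reindex (inj₂ ∘ outSrc) (values-linearModulo nodes-linear n))
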